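{- For all integers $m,p,l\geq1$, \[ \sum_{n=1}^{\infty}\frac{H_n^{(p)}}{(n+m)\binom{n+m+l}{l}} =\sum_{j=0}^{l-1}\binom{l-1}{j}(-1)^{j}\left\{\frac{(-1)^{p-1}H_{m+j}}{(m+j)^{p}}+\sum_{k=1}^{p-1}\frac{(-1)^{k-1}}{(m+j)^{k}}\zeta(p+1-k)\right\}. \]
   Context: $\zeta$ is the Riemann zeta function, $H_n=\sum_{j=1}^{n}1/j$, and $H_n^{(p)}=\sum_{j=1}^{n}1/j^{p}$. Empty sums are zero. -}

module Defs where

open import Data.Nat as ℕ using (ℕ; zero; suc)
open import Data.Nat.Combinatorics using (_C_)
open import Data.Integer using (+_)
open import Data.Rational using (ℚ; 0ℚ; 1ℚ; _+_; _*_; _-_; -_; _/_; ∣_∣; _<_)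
open import Data.Product using (Σ; ∃)

-- reciprocal 1/k of a natural number (convention 1/0 := 0; never used below,
-- since all denominators are ≥ 1 under the hypotheses m,l,p ≥ 1)
recip : ℕ → ℚ
recip zero    = 0ℚ
recip (suc k) = + 1 / suc k

sum1 : ℕ → (ℕ → ℚ) → ℚ
sum1 zero    f = 0ℚ
sum1 (suc N) f = sum1 N f + f (suc N)

sum0 : ℕ → (ℕ → ℚ) → ℚ
sum0 zero    f = 0ℚ
sum0 (suc N) f = sum0 N f + f N

negOnePow : ℕ → ℚ
negOnePow zero    = 1ℚ
negOnePow (suc j) = - negOnePow j

H : ℕ → ℕ → ℚ
H p n = sum1 n (λ j → recip (j ℕ.^ p))

zetaPartial : ℕ → ℕ → ℚ
zetaPartial s N = H s N

Tendsto : (ℕ → ℚ) → ℚ → Set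
Tendsto a L = ∀ (ε : ℚ) → 0ℚ < ε → ∃ λ N₀ → ∀ N → N₀ ℕ.≤ N → ∣ a N - L ∣ < ε

lhsPartial : ℕ → ℕ → ℕ → ℕ → ℚ
lhsPartial m p l N =
  sum1 N (λ n → H p n * recip ((n ℕ.+ m) ℕ.* ((n ℕ.+ m ℕ.+ l) C l)))

-- right-hand side with every ζ(s) replaced by its N-th partial sum ζ_N(s)
rhsWith : (ℕ → ℚ) → ℕ → ℕ → ℕ → ℚ
rhsWith ζ m p l =
  sum0 l (λ j → (+ ((l ℕ.∸ 1) C j) / 1) * negOnePow j *
    ( negOnePow (p ℕ.∸ 1) * H 1 (m ℕ.+ j) * recip ((m ℕ.+ j) ℕ.^ p)
    + sum1 (p ℕ.∸ 1) (λ k → negOnePow (k ℕ.∸ 1) * recip ((m ℕ.+ j) ℕ.^ k)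
                            * ζ (p ℕ.+ 1 ℕ.∸ k))))

rhsPartial : ℕ → ℕ → ℕ → ℕ → ℚ
rhsPartial m p l N = rhsWith (λ s → zetaPartial s N) m p l

-- Write D(m,l,N) for the left partial sum minus the right-hand side with every ζ(s)
-- truncated at N. The summand weight 1/(x·C(x+l,l)), x = n+m, satisfies
-- W_{l+1}(x) = W_l(x) − W_l(x+1), and the binomials C(l−1,j) on the right obey
-- Pascal's rule, so D(m,l+1,N) = D(m,l,N) − D(m+1,l,N) and only l = 1 needs work.
-- There, summation by parts turns the left side into Σ_{n≤N} 1/(n^p(n+m)) −
-- H_N^{(p)}/(N+m+1), and the partial fraction expansion of 1/(n^p(n+m)) reduces
-- D(m,1,N) to (−1)^{p−1} m^{−p} (H_N − H_{N+m}) − H_N^{(p)}/(N+m+1). Both terms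
-- tend to 0, the last one because H_N ≤ K + N/K for every K ≥ 1.

module Submission where

open import Defs
open import Data.Nat as ℕ using (ℕ; zero; suc; _≤_; z≤n; s≤s; _⊔_)
import Data.Nat.Properties as ℕP
open import Data.Nat.Combinatorics using (_C_; nCk+nC[k+1]≡[n+1]C[k+1]; nC1≡n; nCk≡nC[n∸k])
open import Data.Nat.Combinatorics.Specification using (k>n⇒nCk≡0)
open import Data.Integer as ℤ using (+_; +0; +[1+_]; -[1+_])
import Data.Integer.Properties as ℤP
import Data.Integer.Solver as ℤSolver
import Data.Nat.Solver as ℕSolver
open import Data.Rational as ℚ using (ℚ; 0ℚ; 1ℚ; ½; _+_; _*_; _-_; -_; _/_; ∣_∣; _<_; mkℚ; toℚᵘ)
import Data.Rational.Properties as ℚP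
import Data.Rational.Solver as ℚSolver
open import Data.Rational.Unnormalised as ℚᵘ using (mkℚᵘ; *≡*; *≤*; *<*) renaming (_≃_ to _≃ᵘ_)
import Data.Rational.Unnormalised.Properties as ℚᵘP
open import Data.Product using (∃; _,_)
open import Relation.Binary.PropositionalEquality
open import Relation.Nullary using (yes; no)

open ≡-Reasoning


fromℕ : ℕ → ℚ
fromℕ n = + n / 1

toℚᵘ-fromℕ : ∀ n → toℚᵘ (fromℕ n) ≃ᵘ mkℚᵘ (+ n) 0
toℚᵘ-fromℕ n = ℚP.toℚᵘ-fromℚᵘ (mkℚᵘ (+ n) 0)

toℚᵘ-recip : ∀ k → toℚᵘ (recip (suc k)) ≃ᵘ mkℚᵘ (+ 1) k
toℚᵘ-recip k = ℚP.toℚᵘ-fromℚᵘ (mkℚᵘ (+ 1) k)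

fromℕ-+ : ∀ a b → fromℕ (a ℕ.+ b) ≡ fromℕ a + fromℕ b
fromℕ-+ a b = ℚP.toℚᵘ-injective (begin-≃
  toℚᵘ (fromℕ (a ℕ.+ b))              ≈⟨ toℚᵘ-fromℕ (a ℕ.+ b) ⟩
  mkℚᵘ (+ (a ℕ.+ b)) 0                ≈⟨ *≡* (cong (ℤ._* + 1) (trans (ℤP.pos-+ a b)
                                           (solve 2 (λ x y → x :+ y := x :* con (+ 1) :+ y :* con (+ 1)) refl (+ a) (+ b)))) ⟩
  mkℚᵘ (+ a) 0 ℚᵘ.+ mkℚᵘ (+ b) 0      ≈⟨ ℚᵘP.+-cong (ℚᵘP.≃-sym (toℚᵘ-fromℕ a)) (ℚᵘP.≃-sym (toℚᵘ-fromℕ b)) ⟩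
  toℚᵘ (fromℕ a) ℚᵘ.+ toℚᵘ (fromℕ b)  ≈⟨ ℚᵘP.≃-sym (ℚP.toℚᵘ-homo-+ (fromℕ a) (fromℕ b)) ⟩
  toℚᵘ (fromℕ a + fromℕ b)            ∎ᵘ)
  where open ℚᵘP.≃-Reasoning renaming (begin_ to begin-≃_; _∎ to _∎ᵘ)
        open ℤSolver.+-*-Solver

fromℕ*recip≡1 : ∀ k → fromℕ (suc k) * recip (suc k) ≡ 1ℚ
fromℕ*recip≡1 k = ℚP.toℚᵘ-injective (begin-≃
  toℚᵘ (fromℕ (suc k) * recip (suc k))           ≈⟨ ℚP.toℚᵘ-homo-* (fromℕ (suc k)) (recip (suc k)) ⟩
  toℚᵘ (fromℕ (suc k)) ℚᵘ.* toℚᵘ (recip (suc k)) ≈⟨ ℚᵘP.*-cong (toℚᵘ-fromℕ (suc k)) (toℚᵘ-recip k) ⟩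
  mkℚᵘ (+ suc k) 0 ℚᵘ.* mkℚᵘ (+ 1) k             ≈⟨ *≡* (solve 1 (λ x → (x :* con (+ 1)) :* con (+ 1) := con (+ 1) :* (con (+ 1) :* x)) refl (+ suc k)) ⟩
  toℚᵘ 1ℚ                                        ∎ᵘ)
  where open ℚᵘP.≃-Reasoning renaming (begin_ to begin-≃_; _∎ to _∎ᵘ)
        open ℤSolver.+-*-Solver

recip*fromℕ≡1 : ∀ k → recip (suc k) * fromℕ (suc k) ≡ 1ℚ
recip*fromℕ≡1 k = trans (ℚP.*-comm (recip (suc k)) (fromℕ (suc k))) (fromℕ*recip≡1 k)

recip-* : ∀ u v → recip (u ℕ.* v) ≡ recip u * recip v
recip-* zero    v       = sym (ℚP.*-zeroˡ (recip v))
recip-* (suc u) zero    = trans (cong recip (ℕP.*-zeroʳ u)) (sym (ℚP.*-zeroʳ (recip (suc u))))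
recip-* (suc u) (suc v) = ℚP.toℚᵘ-injective (begin-≃
  toℚᵘ (recip (suc u ℕ.* suc v))                 ≈⟨ toℚᵘ-recip (v ℕ.+ u ℕ.* suc v) ⟩
  mkℚᵘ (+ 1) u ℚᵘ.* mkℚᵘ (+ 1) v                 ≈⟨ ℚᵘP.*-cong (ℚᵘP.≃-sym (toℚᵘ-recip u)) (ℚᵘP.≃-sym (toℚᵘ-recip v)) ⟩
  toℚᵘ (recip (suc u)) ℚᵘ.* toℚᵘ (recip (suc v)) ≈⟨ ℚᵘP.≃-sym (ℚP.toℚᵘ-homo-* (recip (suc u)) (recip (suc v))) ⟩
  toℚᵘ (recip (suc u) * recip (suc v))           ∎ᵘ)
  where open ℚᵘP.≃-Reasoning renaming (begin_ to begin-≃_; _∎ to _∎ᵘ)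

recip-cancelˡ : ∀ k {x y} → recip (suc k) * x ≡ y → x ≡ fromℕ (suc k) * y
recip-cancelˡ k {x} {y} eq = begin
  x                                       ≡⟨ sym (ℚP.*-identityˡ x) ⟩
  1ℚ * x                                  ≡⟨ cong (_* x) (sym (fromℕ*recip≡1 k)) ⟩
  fromℕ (suc k) * recip (suc k) * x       ≡⟨ ℚP.*-assoc (fromℕ (suc k)) (recip (suc k)) x ⟩
  fromℕ (suc k) * (recip (suc k) * x)     ≡⟨ cong (fromℕ (suc k) *_) eq ⟩
  fromℕ (suc k) * y                       ∎

recip-difference : ∀ x d → recip (suc x) * fromℕ d * recip (suc x ℕ.+ d) ≡ recip (suc x) - recip (suc x ℕ.+ d)
recip-difference x d = begin
  u * fromℕ d * v                               ≡⟨ solve 4 (λ u v X D → u :* D :* v := u :* (v :* (X :+ D)) :- v :* (u :* X)) refl u v X (fromℕ d) ⟩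
  u * (v * (X + fromℕ d)) - v * (u * X)         ≡⟨ cong₂ (λ s t → u * (v * s) - v * t) (sym (fromℕ-+ (suc x) d)) (recip*fromℕ≡1 x) ⟩
  u * (v * fromℕ (suc x ℕ.+ d)) - v * 1ℚ        ≡⟨ cong₂ (λ s t → u * s - t) (recip*fromℕ≡1 (x ℕ.+ d)) (ℚP.*-identityʳ v) ⟩
  u * 1ℚ - v                                    ≡⟨ cong (_- v) (ℚP.*-identityʳ u) ⟩
  u - v                                         ∎
  where open ℚSolver.+-*-Solver
        u = recip (suc x)
        v = recip (suc x ℕ.+ d)
        X = fromℕ (suc x)

fromℕ-nonNeg : ∀ n → 0ℚ ℚ.≤ fromℕ n
fromℕ-nonNeg n = ℚP.nonNegative⁻¹ (fromℕ n) {{ℚP.normalize-nonNeg n 1}}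

recip-nonNeg : ∀ n → 0ℚ ℚ.≤ recip n
recip-nonNeg zero    = ℚP.≤-refl
recip-nonNeg (suc k) = ℚP.nonNegative⁻¹ (recip (suc k)) {{ℚP.normalize-nonNeg 1 (suc k)}}

*-nonNeg : ∀ {p q} → 0ℚ ℚ.≤ p → 0ℚ ℚ.≤ q → 0ℚ ℚ.≤ p * q
*-nonNeg {p} {q} p≥0 q≥0 = ℚP.nonNegative⁻¹ (p * q) {{ℚP.nonNeg*nonNeg⇒nonNeg p {{ℚ.nonNegative p≥0}} q {{ℚ.nonNegative q≥0}}}}

fromℕ-mono : ∀ {a b} → a ≤ b → fromℕ a ℚ.≤ fromℕ b
fromℕ-mono {a} {b} a≤b = ℚP.toℚᵘ-cancel-≤
  (ℚᵘP.≤-respʳ-≃ (ℚᵘP.≃-sym (toℚᵘ-fromℕ b)) (ℚᵘP.≤-respˡ-≃ (ℚᵘP.≃-sym (toℚᵘ-fromℕ a))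
    (*≤* (subst₂ ℤ._≤_ (sym (ℤP.*-identityʳ (+ a))) (sym (ℤP.*-identityʳ (+ b))) (ℤ.+≤+ a≤b)))))

fromℕ*recip≤1 : ∀ n → fromℕ n * recip (suc n) ℚ.≤ 1ℚ
fromℕ*recip≤1 n = subst (fromℕ n * recip (suc n) ℚ.≤_) (fromℕ*recip≡1 n)
  (ℚP.*-monoʳ-≤-nonNeg (recip (suc n)) {{ℚ.nonNegative (recip-nonNeg (suc n))}} (fromℕ-mono (ℕP.n≤1+n n)))

recip-antitone : ∀ {a b} → 1 ≤ a → a ≤ b → recip b ℚ.≤ recip a
recip-antitone {suc a} {suc b} _ (s≤s a≤b) = ℚP.toℚᵘ-cancel-≤
  (ℚᵘP.≤-respʳ-≃ (ℚᵘP.≃-sym (toℚᵘ-recip a)) (ℚᵘP.≤-respˡ-≃ (ℚᵘP.≃-sym (toℚᵘ-recip b))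
    (*≤* (subst₂ ℤ._≤_ (sym (ℤP.*-identityˡ (+ suc a))) (sym (ℤP.*-identityˡ (+ suc b))) (ℤ.+≤+ (s≤s a≤b))))))

recip≤1 : ∀ n → recip n ℚ.≤ 1ℚ
recip≤1 zero    = ℚP.<⇒≤ (ℚP.positive⁻¹ 1ℚ)
recip≤1 (suc n) = recip-antitone {1} {suc n} ℕP.≤-refl (s≤s z≤n)

-- For ε = (n+1)/(d+1) one may take K = d+1.
recip[1+K]<ε : ∀ ε → 0ℚ < ε → ∃ λ K → recip (suc K) < ε
recip[1+K]<ε (mkℚ +[1+ n ] d _) _ = suc d , ℚP.toℚᵘ-cancel-< (ℚᵘP.<-respˡ-≃ (ℚᵘP.≃-sym (toℚᵘ-recip (suc d)))
  (*<* (subst (ℤ._< +[1+ n ] ℤ.* + suc (suc d)) (sym (ℤP.*-identityˡ (+ suc d))) (ℤ.+<+ (ℕP.<-≤-trans (ℕP.n<1+n (suc d)) (ℕP.m≤n*m (suc (suc d)) (suc n)))))))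
recip[1+K]<ε (mkℚ +0       _ _) (ℚ.*<* (ℤ.+<+ ()))
recip[1+K]<ε (mkℚ -[1+ _ ] _ _) (ℚ.*<* ())

∣negOnePow∣≡1 : ∀ j → ∣ negOnePow j ∣ ≡ 1ℚ
∣negOnePow∣≡1 zero    = refl
∣negOnePow∣≡1 (suc j) = trans (ℚP.∣-p∣≡∣p∣ (negOnePow j)) (∣negOnePow∣≡1 j)


sum1-cong : ∀ N {f g : ℕ → ℚ} → (∀ i → 1 ≤ i → i ≤ N → f i ≡ g i) → sum1 N f ≡ sum1 N g
sum1-cong zero    eq = refl
sum1-cong (suc N) eq = cong₂ _+_ (sum1-cong N (λ i 1≤i i≤N → eq i 1≤i (ℕP.m≤n⇒m≤1+n i≤N))) (eq (suc N) (s≤s z≤n) ℕP.≤-refl)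

sum1-+ : ∀ N (f g : ℕ → ℚ) → sum1 N (λ i → f i + g i) ≡ sum1 N f + sum1 N g
sum1-+ zero    f g = refl
sum1-+ (suc N) f g = trans (cong (_+ (f (suc N) + g (suc N))) (sum1-+ N f g))
  (solve 4 (λ a b c d → (a :+ b) :+ (c :+ d) := (a :+ c) :+ (b :+ d)) refl (sum1 N f) (sum1 N g) (f (suc N)) (g (suc N)))
  where open ℚSolver.+-*-Solver

sum1-- : ∀ N (f g : ℕ → ℚ) → sum1 N (λ i → f i - g i) ≡ sum1 N f - sum1 N g
sum1-- zero    f g = refl
sum1-- (suc N) f g = trans (cong (_+ (f (suc N) - g (suc N))) (sum1-- N f g))
  (solve 4 (λ a b c d → (a :- b) :+ (c :- d) := (a :+ c) :- (b :+ d)) refl (sum1 N f) (sum1 N g) (f (suc N)) (g (suc N)))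
  where open ℚSolver.+-*-Solver

sum1-*ˡ : ∀ N c (f : ℕ → ℚ) → sum1 N (λ i → c * f i) ≡ c * sum1 N f
sum1-*ˡ zero    c f = sym (ℚP.*-zeroʳ c)
sum1-*ˡ (suc N) c f = trans (cong (_+ c * f (suc N)) (sum1-*ˡ N c f)) (sym (ℚP.*-distribˡ-+ c (sum1 N f) (f (suc N))))

sum1-zero : ∀ N → sum1 N (λ _ → 0ℚ) ≡ 0ℚ
sum1-zero zero    = refl
sum1-zero (suc N) = cong (_+ 0ℚ) (sum1-zero N)

sum1-comm : ∀ N K (g : ℕ → ℕ → ℚ) → sum1 N (λ n → sum1 K (g n)) ≡ sum1 K (λ k → sum1 N (λ n → g n k))
sum1-comm zero    K g = sym (sum1-zero K)
sum1-comm (suc N) K g = trans (cong (_+ sum1 K (g (suc N))) (sum1-comm N K g)) (sym (sum1-+ K _ (g (suc N))))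

sum1-telescope : ∀ (f : ℕ → ℚ) a N → sum1 N (λ n → f n - f (n ℕ.+ a)) ≡ sum1 N f - sum1 (N ℕ.+ a) f + sum1 a f
sum1-telescope f a zero    = solve 1 (λ x → con 0ℚ := con 0ℚ :- x :+ x) refl (sum1 a f)
  where open ℚSolver.+-*-Solver
sum1-telescope f a (suc N) = trans (cong (_+ (f (suc N) - f (suc N ℕ.+ a))) (sum1-telescope f a N))
  (solve 5 (λ S S′ A x y → S :- S′ :+ A :+ (x :- y) := S :+ x :- (S′ :+ y) :+ A) refl (sum1 N f) (sum1 (N ℕ.+ a) f) (sum1 a f) (f (suc N)) (f (suc N ℕ.+ a)))
  where open ℚSolver.+-*-Solver

summation-by-parts : ∀ N (h u : ℕ → ℚ) →
  sum1 N (λ n → sum1 n h * (u n - u (suc n))) ≡ sum1 N (λ n → h n * u n) - sum1 N h * u (suc N)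
summation-by-parts zero    h u = solve 1 (λ x → con 0ℚ := con 0ℚ :- con 0ℚ :* x) refl (u 1)
  where open ℚSolver.+-*-Solver
summation-by-parts (suc N) h u = begin
  sum1 N (λ n → sum1 n h * (u n - u (suc n))) + (S + h n) * (u n - u (suc n)) ≡⟨ cong (_+ (S + h n) * (u n - u (suc n))) (summation-by-parts N h u) ⟩
  T - S * u n + (S + h n) * (u n - u (suc n))                                  ≡⟨ solve 5 (λ T S h u v → T :- S :* u :+ (S :+ h) :* (u :- v) := (T :+ h :* u) :- (S :+ h) :* v) refl T S (h n) (u n) (u (suc n)) ⟩
  (T + h n * u n) - (S + h n) * u (suc n)                                      ∎
  where open ℚSolver.+-*-Solver
        n = suc N
        S = sum1 N h
        T = sum1 N (λ i → h i * u i)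

sum0-cong : ∀ N {f g : ℕ → ℚ} → (∀ i → f i ≡ g i) → sum0 N f ≡ sum0 N g
sum0-cong zero    eq = refl
sum0-cong (suc N) eq = cong₂ _+_ (sum0-cong N eq) (eq N)


[1+k]*[1+n]C[1+k]≡[1+n]*nCk : ∀ n k → suc k ℕ.* (suc n C suc k) ≡ suc n ℕ.* (n C k)
[1+k]*[1+n]C[1+k]≡[1+n]*nCk zero    zero    = refl
[1+k]*[1+n]C[1+k]≡[1+n]*nCk zero    (suc k) rewrite k>n⇒nCk≡0 {1} {suc (suc k)} (s≤s (s≤s z≤n)) | k>n⇒nCk≡0 {0} {suc k} (s≤s z≤n) = ℕP.*-zeroʳ (suc (suc k))
[1+k]*[1+n]C[1+k]≡[1+n]*nCk (suc n) zero    = trans (cong (λ c → c ℕ.+ 0) (nC1≡n (suc (suc n)))) (trans (ℕP.+-identityʳ (suc (suc n))) (sym (ℕP.*-identityʳ (suc (suc n)))))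
[1+k]*[1+n]C[1+k]≡[1+n]*nCk (suc n) (suc k) = begin
  suc (suc k) ℕ.* (suc (suc n) C suc (suc k))       ≡⟨ cong (suc (suc k) ℕ.*_) (sym (nCk+nC[k+1]≡[n+1]C[k+1] (suc n) (suc k))) ⟩
  suc (suc k) ℕ.* (A ℕ.+ B)                         ≡⟨ solve 3 (λ k A B → (con 2 :+ k) :* (A :+ B) := A :+ (con 1 :+ k) :* A :+ (con 2 :+ k) :* B) refl k A B ⟩
  A ℕ.+ suc k ℕ.* A ℕ.+ suc (suc k) ℕ.* B           ≡⟨ cong₂ (λ s t → A ℕ.+ s ℕ.+ t) ([1+k]*[1+n]C[1+k]≡[1+n]*nCk n k) ([1+k]*[1+n]C[1+k]≡[1+n]*nCk n (suc k)) ⟩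
  A ℕ.+ suc n ℕ.* (n C k) ℕ.+ suc n ℕ.* (n C suc k) ≡⟨ solve 4 (λ A n a b → A :+ (con 1 :+ n) :* a :+ (con 1 :+ n) :* b := A :+ (con 1 :+ n) :* (a :+ b)) refl A n (n C k) (n C suc k) ⟩
  A ℕ.+ suc n ℕ.* (n C k ℕ.+ n C suc k)             ≡⟨ cong (λ c → A ℕ.+ suc n ℕ.* c) (nCk+nC[k+1]≡[n+1]C[k+1] n k) ⟩
  suc (suc n) ℕ.* A                                 ∎
  where open ℕSolver.+-*-Solver
        A = suc n C suc k
        B = suc n C suc (suc k)

C-sym : ∀ {n k j} → k ≤ n → n ℕ.∸ k ≡ j → n C k ≡ n C j
C-sym {n} k≤n n∸k≡j = trans (nCk≡nC[n∸k] k≤n) (cong (n C_) n∸k≡j)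

[1+x]*[1+x+l]Cl≡[1+x+l]*[x+l]Cl : ∀ x l → suc x ℕ.* (suc (x ℕ.+ l) C l) ≡ suc (x ℕ.+ l) ℕ.* ((x ℕ.+ l) C l)
[1+x]*[1+x+l]Cl≡[1+x+l]*[x+l]Cl x l = begin
  suc x ℕ.* (suc (x ℕ.+ l) C l)      ≡⟨ cong (suc x ℕ.*_) (C-sym (ℕP.m≤n⇒m≤1+n (ℕP.m≤n+m l x)) (ℕP.m+n∸n≡m (suc x) l)) ⟩
  suc x ℕ.* (suc (x ℕ.+ l) C suc x)  ≡⟨ [1+k]*[1+n]C[1+k]≡[1+n]*nCk (x ℕ.+ l) x ⟩
  suc (x ℕ.+ l) ℕ.* ((x ℕ.+ l) C x)  ≡⟨ cong (suc (x ℕ.+ l) ℕ.*_) (C-sym (ℕP.m≤m+n x l) (ℕP.m+n∸m≡n x l)) ⟩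
  suc (x ℕ.+ l) ℕ.* ((x ℕ.+ l) C l)  ∎


-- Reduction to l = 1

-- lhsPartial m p l N is definitionally sum1 N (λ n → H p n * weight l (n + m)).
weight : ℕ → ℕ → ℚ
weight l x = recip (x ℕ.* ((x ℕ.+ l) C l))

weight-step : ∀ l x → weight (suc l) (suc x) ≡ weight l (suc x) - weight l (suc (suc x))
weight-step l x = begin
  recip (suc x ℕ.* ((suc x ℕ.+ suc l) C suc l))   ≡⟨ cong (λ y → recip (suc x ℕ.* (y C suc l))) (ℕP.+-suc (suc x) l) ⟩
  recip (suc x ℕ.* (s C suc l))                  ≡⟨ recip-* (suc x) (s C suc l) ⟩
  u * recip (s C suc l)                          ≡⟨ cong (u *_) recip[sC[1+l]] ⟩
  u * (fromℕ (suc l) * (v * w))                  ≡⟨ solve 4 (λ u L v w → u :* (L :* (v :* w)) := u :* L :* v :* w) refl u (fromℕ (suc l)) v w ⟩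
  u * fromℕ (suc l) * v * w                      ≡⟨ cong (λ y → u * fromℕ (suc l) * recip y * w) (sym (ℕP.+-suc (suc x) l)) ⟩
  u * fromℕ (suc l) * recip (suc x ℕ.+ suc l) * w ≡⟨ cong (_* w) (recip-difference x (suc l)) ⟩
  (u - recip (suc x ℕ.+ suc l)) * w              ≡⟨ cong (λ y → (u - recip y) * w) (ℕP.+-suc (suc x) l) ⟩
  (u - v) * w                                    ≡⟨ solve 3 (λ u v w → (u :- v) :* w := u :* w :- v :* w) refl u v w ⟩
  u * w - v * w                                  ≡⟨ cong₂ _-_ (sym (recip-* (suc x) c)) (sym (recip-* s c)) ⟩
  recip (suc x ℕ.* c) - recip (s ℕ.* c)          ≡⟨ cong (λ y → recip (suc x ℕ.* c) - recip y) (sym ([1+x]*[1+x+l]Cl≡[1+x+l]*[x+l]Cl (suc x) l)) ⟩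
  weight l (suc x) - weight l (suc (suc x))      ∎
  where open ℚSolver.+-*-Solver
        s = suc (suc x ℕ.+ l)
        c = (suc x ℕ.+ l) C l
        u = recip (suc x)
        v = recip s
        w = recip c
        recip[sC[1+l]] : recip (s C suc l) ≡ fromℕ (suc l) * (v * w)
        recip[sC[1+l]] = recip-cancelˡ l (begin
          recip (suc l) * recip (s C suc l) ≡⟨ sym (recip-* (suc l) (s C suc l)) ⟩
          recip (suc l ℕ.* (s C suc l))     ≡⟨ cong recip ([1+k]*[1+n]C[1+k]≡[1+n]*nCk (suc x ℕ.+ l) l) ⟩
          recip (s ℕ.* c)                   ≡⟨ recip-* s c ⟩
          v * w                             ∎)

lhsPartial-step : ∀ m p l N → lhsPartial (suc m) p (suc l) N ≡ lhsPartial (suc m) p l N - lhsPartial (suc (suc m)) p l N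
lhsPartial-step m p l N = trans (sum1-cong N (λ n _ _ → term n)) (sum1-- N _ _)
  where
    term : ∀ n → H p n * weight (suc l) (n ℕ.+ suc m) ≡ H p n * weight l (n ℕ.+ suc m) - H p n * weight l (n ℕ.+ suc (suc m))
    term n = begin
      H p n * weight (suc l) (n ℕ.+ suc m)                                    ≡⟨ cong (λ y → H p n * weight (suc l) y) (ℕP.+-suc n m) ⟩
      H p n * weight (suc l) (suc (n ℕ.+ m))                                  ≡⟨ cong (H p n *_) (weight-step l (n ℕ.+ m)) ⟩
      H p n * (weight l (suc (n ℕ.+ m)) - weight l (suc (suc (n ℕ.+ m))))      ≡⟨ solve 3 (λ h x y → h :* (x :- y) := h :* x :- h :* y) refl (H p n) _ _ ⟩
      H p n * weight l (suc (n ℕ.+ m)) - H p n * weight l (suc (suc (n ℕ.+ m))) ≡⟨ cong₂ (λ y z → H p n * weight l y - H p n * weight l z) (sym (ℕP.+-suc n m)) 2+n+m≡n+[2+m] ⟩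
      H p n * weight l (n ℕ.+ suc m) - H p n * weight l (n ℕ.+ suc (suc m))     ∎
      where open ℚSolver.+-*-Solver
            2+n+m≡n+[2+m] : suc (suc (n ℕ.+ m)) ≡ n ℕ.+ suc (suc m)
            2+n+m≡n+[2+m] = sym (trans (ℕP.+-suc n (suc m)) (cong suc (ℕP.+-suc n m)))

alternatingBinomialSum : ℕ → ℕ → (ℕ → ℚ) → ℚ
alternatingBinomialSum n k f = sum0 n (λ j → fromℕ (k C j) * negOnePow j * f j)

alternatingBinomialSum-pascal : ∀ n k f →
  alternatingBinomialSum (suc n) (suc k) f ≡ alternatingBinomialSum (suc n) k f - alternatingBinomialSum n k (λ j → f (suc j))
alternatingBinomialSum-pascal zero    k f = solve 1 (λ x → con 0ℚ :+ con 1ℚ :* con 1ℚ :* x := (con 0ℚ :+ con 1ℚ :* con 1ℚ :* x) :- con 0ℚ) refl (f 0)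
  where open ℚSolver.+-*-Solver
alternatingBinomialSum-pascal (suc n) k f = begin
  alternatingBinomialSum (suc n) (suc k) f + fromℕ (suc k C suc n) * - s * f (suc n) ≡⟨ cong₂ (λ x y → x + fromℕ y * - s * f (suc n)) (alternatingBinomialSum-pascal n k f) (sym (nCk+nC[k+1]≡[n+1]C[k+1] k n)) ⟩
  A - B + fromℕ (k C n ℕ.+ k C suc n) * - s * f (suc n)                              ≡⟨ cong (λ x → A - B + x * - s * f (suc n)) (fromℕ-+ (k C n) (k C suc n)) ⟩
  A - B + (c + c′) * - s * f (suc n)                                                 ≡⟨ solve 6 (λ A B c c′ s F → A :- B :+ (c :+ c′) :* (:- s) :* F := (A :+ c′ :* (:- s) :* F) :- (B :+ c :* s :* F)) refl A B c c′ s (f (suc n)) ⟩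
  (A + c′ * - s * f (suc n)) - (B + c * s * f (suc n))                               ∎
  where open ℚSolver.+-*-Solver
        A = alternatingBinomialSum (suc n) k f
        B = alternatingBinomialSum n k (λ j → f (suc j))
        c = fromℕ (k C n)
        c′ = fromℕ (k C suc n)
        s = negOnePow n

alternatingBinomialSum-step : ∀ k f →
  alternatingBinomialSum (suc (suc k)) (suc k) f ≡ alternatingBinomialSum (suc k) k f - alternatingBinomialSum (suc k) k (λ j → f (suc j))
alternatingBinomialSum-step k f = trans (alternatingBinomialSum-pascal (suc k) k f) (cong (_- alternatingBinomialSum (suc k) k (λ j → f (suc j))) vanishing)
  where
    vanishing : alternatingBinomialSum (suc (suc k)) k f ≡ alternatingBinomialSum (suc k) k f
    vanishing = begin
      alternatingBinomialSum (suc k) k f + fromℕ (k C suc k) * negOnePow (suc k) * f (suc k) ≡⟨ cong (λ c → alternatingBinomialSum (suc k) k f + fromℕ c * negOnePow (suc k) * f (suc k)) (k>n⇒nCk≡0 (ℕP.n<1+n k)) ⟩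
      alternatingBinomialSum (suc k) k f + 0ℚ * negOnePow (suc k) * f (suc k)              ≡⟨ solve 3 (λ a s F → a :+ con 0ℚ :* s :* F := a) refl (alternatingBinomialSum (suc k) k f) (negOnePow (suc k)) (f (suc k)) ⟩
      alternatingBinomialSum (suc k) k f                                                    ∎
      where open ℚSolver.+-*-Solver

zetaCoefficient : ℕ → ℕ → ℚ
zetaCoefficient a k = negOnePow (k ℕ.∸ 1) * recip (a ℕ.^ k)

-- rhsWith ζ m p (suc k) is definitionally
-- alternatingBinomialSum (suc k) k (λ j → rhsTerm ζ p (m + j)).
rhsTerm : (ℕ → ℚ) → ℕ → ℕ → ℚ
rhsTerm ζ p a = negOnePow (p ℕ.∸ 1) * H 1 a * recip (a ℕ.^ p)
  + sum1 (p ℕ.∸ 1) (λ k → zetaCoefficient a k * ζ (p ℕ.+ 1 ℕ.∸ k))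

rhsWith-step : ∀ ζ m p k → rhsWith ζ m p (suc (suc k)) ≡ rhsWith ζ m p (suc k) - rhsWith ζ (suc m) p (suc k)
rhsWith-step ζ m p k = trans (alternatingBinomialSum-step k (λ j → rhsTerm ζ p (m ℕ.+ j)))
  (cong (_-_ (alternatingBinomialSum (suc k) k (λ j → rhsTerm ζ p (m ℕ.+ j))))
        (sum0-cong (suc k) (λ j → cong (λ a → fromℕ (k C j) * negOnePow j * rhsTerm ζ p a) (ℕP.+-suc m j))))

remainder : ℕ → ℕ → ℕ → ℕ → ℚ
remainder m p l N = lhsPartial m p l N - rhsPartial m p l N

remainder-step : ∀ m p l N → remainder (suc m) p (suc (suc l)) N ≡ remainder (suc m) p (suc l) N - remainder (suc (suc m)) p (suc l) N
remainder-step m p l N = begin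
  lhsPartial (suc m) p (suc (suc l)) N - rhsPartial (suc m) p (suc (suc l)) N
    ≡⟨ cong₂ _-_ (lhsPartial-step m p (suc l) N) (rhsWith-step (λ s → zetaPartial s N) (suc m) p l) ⟩
  (L - L′) - (R - R′)
    ≡⟨ solve 4 (λ L L′ R R′ → (L :- L′) :- (R :- R′) := (L :- R) :- (L′ :- R′)) refl L L′ R R′ ⟩
  (L - R) - (L′ - R′) ∎
  where
    open ℚSolver.+-*-Solver
    L = lhsPartial (suc m) p (suc l) N
    L′ = lhsPartial (suc (suc m)) p (suc l) N
    R = rhsPartial (suc m) p (suc l) N
    R′ = rhsPartial (suc (suc m)) p (suc l) N


-- The case l = 1

partialFractionTail : ℕ → ℕ → ℕ → ℚ
partialFractionTail a n p = sum1 (p ℕ.∸ 1) (λ k → zetaCoefficient a k * recip (n ℕ.^ (p ℕ.+ 1 ℕ.∸ k)))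

recip*recip≡recip*[recip-recip] : ∀ a n → recip (suc n) * recip (suc n ℕ.+ suc a) ≡ recip (suc a) * (recip (suc n) - recip (suc n ℕ.+ suc a))
recip*recip≡recip*[recip-recip] a n = begin
  u * v                                   ≡⟨ sym (ℚP.*-identityˡ (u * v)) ⟩
  1ℚ * (u * v)                            ≡⟨ cong (_* (u * v)) (sym (recip*fromℕ≡1 a)) ⟩
  recip (suc a) * fromℕ (suc a) * (u * v) ≡⟨ solve 4 (λ u v r A → r :* A :* (u :* v) := r :* (u :* A :* v)) refl u v (recip (suc a)) (fromℕ (suc a)) ⟩
  recip (suc a) * (u * fromℕ (suc a) * v) ≡⟨ cong (recip (suc a) *_) (recip-difference n (suc a)) ⟩
  recip (suc a) * (u - v)                 ∎
  where open ℚSolver.+-*-Solver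
        u = recip (suc n)
        v = recip (suc n ℕ.+ suc a)

partialFractionTail-step : ∀ a n p → partialFractionTail a (suc n) (suc (suc p)) ≡
  recip (suc n) * partialFractionTail a (suc n) (suc p) + zetaCoefficient a (suc p) * (recip (suc n) * recip (suc n))
partialFractionTail-step a n p =
  cong₂ _+_ (trans (sum1-cong p shifted) (sum1-*ˡ p (recip (suc n)) (λ k → zetaCoefficient a k * recip (suc n ℕ.^ (suc p ℕ.+ 1 ℕ.∸ k)))))
            (cong (zetaCoefficient a (suc p) *_) last)
  where
    shifted : ∀ k → 1 ≤ k → k ≤ p → zetaCoefficient a k * recip (suc n ℕ.^ (suc (suc p) ℕ.+ 1 ℕ.∸ k))
                                   ≡ recip (suc n) * (zetaCoefficient a k * recip (suc n ℕ.^ (suc p ℕ.+ 1 ℕ.∸ k)))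
    shifted k _ k≤p = begin
      zetaCoefficient a k * recip (suc n ℕ.^ (suc (suc p) ℕ.+ 1 ℕ.∸ k))     ≡⟨ cong (λ e → zetaCoefficient a k * recip (suc n ℕ.^ e)) (ℕP.+-∸-assoc 1 (ℕP.m≤n⇒m≤n+o 1 (ℕP.m≤n⇒m≤1+n k≤p))) ⟩
      zetaCoefficient a k * recip (suc n ℕ.* suc n ℕ.^ e)                   ≡⟨ cong (zetaCoefficient a k *_) (recip-* (suc n) (suc n ℕ.^ e)) ⟩
      zetaCoefficient a k * (recip (suc n) * recip (suc n ℕ.^ e))           ≡⟨ solve 3 (λ c r s → c :* (r :* s) := r :* (c :* s)) refl (zetaCoefficient a k) (recip (suc n)) (recip (suc n ℕ.^ e)) ⟩
      recip (suc n) * (zetaCoefficient a k * recip (suc n ℕ.^ e))           ∎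
      where open ℚSolver.+-*-Solver
            e = suc p ℕ.+ 1 ℕ.∸ k
    [p+2]∸p≡2 : ∀ p → suc p ℕ.+ 1 ℕ.∸ p ≡ 2
    [p+2]∸p≡2 zero    = refl
    [p+2]∸p≡2 (suc p) = [p+2]∸p≡2 p
    last : recip (suc n ℕ.^ (suc (suc p) ℕ.+ 1 ℕ.∸ suc p)) ≡ recip (suc n) * recip (suc n)
    last = begin
      recip (suc n ℕ.^ (suc p ℕ.+ 1 ℕ.∸ p)) ≡⟨ cong (λ e → recip (suc n ℕ.^ e)) ([p+2]∸p≡2 p) ⟩
      recip (suc n ℕ.* (suc n ℕ.* 1))       ≡⟨ cong (λ m → recip (suc n ℕ.* m)) (ℕP.*-identityʳ (suc n)) ⟩
      recip (suc n ℕ.* suc n)               ≡⟨ recip-* (suc n) (suc n) ⟩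
      recip (suc n) * recip (suc n)         ∎

partialFractions : ∀ a n p → recip (suc n ℕ.^ suc p) * recip (suc n ℕ.+ suc a) ≡
  partialFractionTail (suc a) (suc n) (suc p) + negOnePow p * recip (suc a ℕ.^ suc p) * (recip (suc n) - recip (suc n ℕ.+ suc a))
partialFractions a n zero = begin
  recip (suc n ℕ.^ 1) * v           ≡⟨ cong (λ m → recip m * v) (ℕP.^-identityʳ (suc n)) ⟩
  u * v                             ≡⟨ recip*recip≡recip*[recip-recip] a n ⟩
  recip (suc a) * (u - v)           ≡⟨ cong (λ m → recip m * (u - v)) (sym (ℕP.^-identityʳ (suc a))) ⟩
  recip (suc a ℕ.^ 1) * (u - v)     ≡⟨ solve 2 (λ r d → r :* d := con 0ℚ :+ con 1ℚ :* r :* d) refl (recip (suc a ℕ.^ 1)) (u - v) ⟩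
  0ℚ + 1ℚ * recip (suc a ℕ.^ 1) * (u - v) ∎
  where open ℚSolver.+-*-Solver
        u = recip (suc n)
        v = recip (suc n ℕ.+ suc a)
partialFractions a n (suc p) = begin
  recip (suc n ℕ.^ suc (suc p)) * v                       ≡⟨ cong (_* v) (recip-* (suc n) (suc n ℕ.^ suc p)) ⟩
  u * recip (suc n ℕ.^ suc p) * v                         ≡⟨ ℚP.*-assoc u (recip (suc n ℕ.^ suc p)) v ⟩
  u * (recip (suc n ℕ.^ suc p) * v)                       ≡⟨ cong (u *_) (partialFractions a n p) ⟩
  u * (F + s * A * (u - v))                               ≡⟨ solve 5 (λ u v F s A → u :* (F :+ s :* A :* (u :- v)) := u :* F :+ s :* A :* (u :* u) :- s :* A :* (u :* v)) refl u v F s A ⟩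
  u * F + s * A * (u * u) - s * A * (u * v)               ≡⟨ cong₂ (λ x y → x - s * A * y) (sym (partialFractionTail-step (suc a) n p)) (recip*recip≡recip*[recip-recip] a n) ⟩
  F′ - s * A * (recip (suc a) * (u - v))                   ≡⟨ solve 6 (λ F′ s A r u v → F′ :- s :* A :* (r :* (u :- v)) := F′ :+ (:- s) :* (r :* A) :* (u :- v)) refl F′ s A (recip (suc a)) u v ⟩
  F′ + - s * (recip (suc a) * A) * (u - v)                  ≡⟨ cong (λ x → F′ + - s * x * (u - v)) (sym (recip-* (suc a) (suc a ℕ.^ suc p))) ⟩
  F′ + - s * recip (suc a ℕ.^ suc (suc p)) * (u - v)        ∎
  where open ℚSolver.+-*-Solver
        u = recip (suc n)
        v = recip (suc n ℕ.+ suc a)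
        F = partialFractionTail (suc a) (suc n) (suc p)
        F′ = partialFractionTail (suc a) (suc n) (suc (suc p))
        s = negOnePow p
        A = recip (suc a ℕ.^ suc p)

sum1-partialFractions : ∀ a p N →
  sum1 N (λ n → recip (n ℕ.^ suc p) * recip (n ℕ.+ suc a)) ≡
  sum1 p (λ k → zetaCoefficient (suc a) k * zetaPartial (suc p ℕ.+ 1 ℕ.∸ k) N)
    + negOnePow p * recip (suc a ℕ.^ suc p) * (H 1 N - H 1 (N ℕ.+ suc a) + H 1 (suc a))
sum1-partialFractions a p N = begin
  sum1 N (λ n → recip (n ℕ.^ suc p) * recip (n ℕ.+ suc a))  ≡⟨ sum1-cong N pointwise ⟩
  sum1 N (λ n → tail n + c * (f n - f (n ℕ.+ suc a)))        ≡⟨ sum1-+ N tail _ ⟩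
  sum1 N tail + sum1 N (λ n → c * (f n - f (n ℕ.+ suc a)))   ≡⟨ cong₂ _+_ tails (sum1-*ˡ N c _) ⟩
  Z + c * sum1 N (λ n → f n - f (n ℕ.+ suc a))               ≡⟨ cong (λ x → Z + c * x) (sum1-telescope f (suc a) N) ⟩
  Z + c * (H 1 N - H 1 (N ℕ.+ suc a) + H 1 (suc a))          ∎
  where
    Z = sum1 p (λ k → zetaCoefficient (suc a) k * zetaPartial (suc p ℕ.+ 1 ℕ.∸ k) N)
    c = negOnePow p * recip (suc a ℕ.^ suc p)
    f : ℕ → ℚ
    f j = recip (j ℕ.^ 1)
    tail : ℕ → ℚ
    tail n = partialFractionTail (suc a) n (suc p)
    recip≡f : ∀ j → recip j ≡ f j
    recip≡f j = cong recip (sym (ℕP.^-identityʳ j))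
    pointwise : ∀ n → 1 ≤ n → n ≤ N → recip (n ℕ.^ suc p) * recip (n ℕ.+ suc a) ≡ tail n + c * (f n - f (n ℕ.+ suc a))
    pointwise (suc n) _ _ = trans (partialFractions a n p) (cong₂ (λ x y → tail (suc n) + c * (x - y)) (recip≡f (suc n)) (recip≡f (suc n ℕ.+ suc a)))
    tails : sum1 N tail ≡ Z
    tails = trans (sum1-comm N p _) (sum1-cong p (λ k _ _ → sum1-*ˡ N (zetaCoefficient (suc a) k) (λ n → recip (n ℕ.^ (suc p ℕ.+ 1 ℕ.∸ k)))))

weight-zero : ∀ x → weight 0 x ≡ recip x
weight-zero x = cong recip (ℕP.*-identityʳ x)

lhsPartial-one : ∀ a p N → lhsPartial (suc a) p 1 N ≡
  sum1 N (λ n → recip (n ℕ.^ p) * recip (n ℕ.+ suc a)) - H p N * recip (suc (N ℕ.+ suc a))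
lhsPartial-one a p N =
  trans (sum1-cong N (λ n _ _ → cong (H p n *_) (weight-one n))) (summation-by-parts N (λ n → recip (n ℕ.^ p)) (λ n → recip (n ℕ.+ suc a)))
  where
    weight-one : ∀ n → weight 1 (n ℕ.+ suc a) ≡ recip (n ℕ.+ suc a) - recip (suc n ℕ.+ suc a)
    weight-one n = begin
      weight 1 (n ℕ.+ suc a)                                 ≡⟨ cong (weight 1) (ℕP.+-suc n a) ⟩
      weight 1 (suc (n ℕ.+ a))                               ≡⟨ weight-step 0 (n ℕ.+ a) ⟩
      weight 0 (suc (n ℕ.+ a)) - weight 0 (suc (suc (n ℕ.+ a))) ≡⟨ cong₂ _-_ (weight-zero (suc (n ℕ.+ a))) (weight-zero (suc (suc (n ℕ.+ a)))) ⟩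
      recip (suc (n ℕ.+ a)) - recip (suc (suc (n ℕ.+ a)))     ≡⟨ cong₂ (λ x y → recip x - recip (suc y)) (sym (ℕP.+-suc n a)) (sym (ℕP.+-suc n a)) ⟩
      recip (n ℕ.+ suc a) - recip (suc n ℕ.+ suc a)           ∎

remainder-one : ∀ a p N → remainder (suc a) (suc p) 1 N ≡
  negOnePow p * recip (suc a ℕ.^ suc p) * (H 1 N - H 1 (N ℕ.+ suc a)) - H (suc p) N * recip (suc (N ℕ.+ suc a))
remainder-one a p N = begin
  lhsPartial (suc a) (suc p) 1 N - (0ℚ + 1ℚ * 1ℚ * rhsTerm ζ (suc p) (suc a ℕ.+ 0))
    ≡⟨ cong₂ (λ x y → x - (0ℚ + 1ℚ * 1ℚ * rhsTerm ζ (suc p) y)) (lhsPartial-one a (suc p) N) (ℕP.+-identityʳ (suc a)) ⟩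
  (T - Hp * r) - (0ℚ + 1ℚ * 1ℚ * (s * Ha * A + Z))
    ≡⟨ cong (λ x → (x - Hp * r) - (0ℚ + 1ℚ * 1ℚ * (s * Ha * A + Z))) (sum1-partialFractions a p N) ⟩
  (Z + s * A * (HN - HNa + Ha) - Hp * r) - (0ℚ + 1ℚ * 1ℚ * (s * Ha * A + Z))
    ≡⟨ solve 8 (λ Z s A HN HNa Ha Hp r → (Z :+ s :* A :* (HN :- HNa :+ Ha) :- Hp :* r) :- (con 0ℚ :+ con 1ℚ :* con 1ℚ :* (s :* Ha :* A :+ Z))
                                         := s :* A :* (HN :- HNa) :- Hp :* r) refl Z s A HN HNa Ha Hp r ⟩
  s * A * (HN - HNa) - Hp * r ∎
  where
    open ℚSolver.+-*-Solver
    ζ = λ s → zetaPartial s N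
    T = sum1 N (λ n → recip (n ℕ.^ suc p) * recip (n ℕ.+ suc a))
    Z = sum1 p (λ k → zetaCoefficient (suc a) k * zetaPartial (suc p ℕ.+ 1 ℕ.∸ k) N)
    s = negOnePow p
    A = recip (suc a ℕ.^ suc p)
    Hp = H (suc p) N
    r = recip (suc (N ℕ.+ suc a))
    HN = H 1 N
    HNa = H 1 (N ℕ.+ suc a)
    Ha = H 1 (suc a)


-- Null sequences

Null : (ℕ → ℚ) → Set
Null x = Tendsto x 0ℚ

∣p-0∣≡∣p∣ : ∀ p → ∣ p - 0ℚ ∣ ≡ ∣ p ∣
∣p-0∣≡∣p∣ p = cong ∣_∣ (ℚP.+-identityʳ p)

null-zero : Null (λ _ → 0ℚ)
null-zero ε ε>0 = 0 , λ _ _ → ε>0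

null-cong : ∀ {x y} → (∀ N → x N ≡ y N) → Null x → Null y
null-cong x≡y x→0 ε ε>0 with x→0 ε ε>0
... | N₀ , small = N₀ , λ N N₀≤N → subst (λ z → ∣ z - 0ℚ ∣ < ε) (x≡y N) (small N N₀≤N)

null-≤ : ∀ {x y} → (∀ N → ∣ x N ∣ ℚ.≤ ∣ y N ∣) → Null y → Null x
null-≤ {x} {y} x≤y y→0 ε ε>0 with y→0 ε ε>0
... | N₀ , small = N₀ , λ N N₀≤N → subst (_< ε) (sym (∣p-0∣≡∣p∣ (x N)))
  (ℚP.≤-<-trans (x≤y N) (subst (_< ε) (∣p-0∣≡∣p∣ (y N)) (small N N₀≤N)))

null-neg : ∀ {x} → Null x → Null (λ N → - x N)
null-neg {x} = null-≤ (λ N → ℚP.≤-reflexive (ℚP.∣-p∣≡∣p∣ (x N)))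

½ε+½ε≡ε : ∀ ε → ½ * ε + ½ * ε ≡ ε
½ε+½ε≡ε = solve 1 (λ ε → con ½ :* ε :+ con ½ :* ε := ε) refl
  where open ℚSolver.+-*-Solver

½ε>0 : ∀ {ε} → 0ℚ < ε → 0ℚ < ½ * ε
½ε>0 = ℚP.*-monoʳ-<-pos ½

null-+ : ∀ {x y} → Null x → Null y → Null (λ N → x N + y N)
null-+ {x} {y} x→0 y→0 ε ε>0 with x→0 (½ * ε) (½ε>0 ε>0) | y→0 (½ * ε) (½ε>0 ε>0)
... | N₁ , x-small | N₂ , y-small = N₁ ⊔ N₂ , λ N N₁⊔N₂≤N →
  subst (_< ε) (sym (∣p-0∣≡∣p∣ (x N + y N)))
    (ℚP.≤-<-trans (ℚP.∣p+q∣≤∣p∣+∣q∣ (x N) (y N))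
      (subst (∣ x N ∣ + ∣ y N ∣ <_) (½ε+½ε≡ε ε)
        (ℚP.+-mono-< (subst (_< ½ * ε) (∣p-0∣≡∣p∣ (x N)) (x-small N (ℕP.≤-trans (ℕP.m≤m⊔n N₁ N₂) N₁⊔N₂≤N)))
                     (subst (_< ½ * ε) (∣p-0∣≡∣p∣ (y N)) (y-small N (ℕP.≤-trans (ℕP.m≤n⊔m N₁ N₂) N₁⊔N₂≤N))))))

null-- : ∀ {x y} → Null x → Null y → Null (λ N → x N - y N)
null-- {x} {y} x→0 y→0 = null-+ {x} {λ N → - y N} x→0 (null-neg {y} y→0)

null-*-fromℕ : ∀ K {x} → Null x → Null (λ N → fromℕ K * x N)
null-*-fromℕ zero    {x} x→0 = null-≤ (λ N → subst (ℚ._≤ ∣ x N ∣) (cong ∣_∣ (sym (ℚP.*-zeroˡ (x N)))) (ℚP.0≤∣p∣ (x N))) x→0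
null-*-fromℕ (suc K) {x} x→0 = null-cong split (null-+ {x} {λ N → fromℕ K * x N} x→0 (null-*-fromℕ K x→0))
  where
    split : ∀ N → x N + fromℕ K * x N ≡ fromℕ (suc K) * x N
    split N = trans (solve 2 (λ x k → x :+ k :* x := (con 1ℚ :+ k) :* x) refl (x N) (fromℕ K))
                    (cong (_* x N) (sym (fromℕ-+ 1 K)))
      where open ℚSolver.+-*-Solver

null-*-bounded : ∀ c K {x} → ∣ c ∣ ℚ.≤ fromℕ K → Null x → Null (λ N → c * x N)
null-*-bounded c K {x} ∣c∣≤K x→0 = null-≤ bound (null-*-fromℕ K x→0)
  where
    bound : ∀ N → ∣ c * x N ∣ ℚ.≤ ∣ fromℕ K * x N ∣
    bound N = subst₂ ℚ._≤_ (sym (ℚP.∣p*q∣≡∣p∣*∣q∣ c (x N)))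
      (trans (cong (_* ∣ x N ∣) (sym (ℚP.0≤p⇒∣p∣≡p (fromℕ-nonNeg K)))) (sym (ℚP.∣p*q∣≡∣p∣*∣q∣ (fromℕ K) (x N))))
      (ℚP.*-monoʳ-≤-nonNeg ∣ x N ∣ {{ℚP.∣-∣-nonNeg (x N)}} ∣c∣≤K)

recip-null : ∀ c → Null (λ N → recip (suc (N ℕ.+ c)))
recip-null c ε ε>0 with recip[1+K]<ε ε ε>0
... | K , 1/K<ε = K , λ N K≤N → subst (_< ε) (sym (trans (∣p-0∣≡∣p∣ _) (ℚP.0≤p⇒∣p∣≡p (recip-nonNeg (suc (N ℕ.+ c))))))
  (ℚP.≤-<-trans (recip-antitone (s≤s z≤n) (s≤s (ℕP.≤-trans K≤N (ℕP.m≤m+n N c)))) 1/K<ε)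

null-≤-+recip : ∀ {x} (y : ℕ → ℕ → ℚ) → (∀ K N → ∣ x N ∣ ℚ.≤ ∣ y K N ∣ + recip (suc K)) → (∀ K → Null (y K)) → Null x
null-≤-+recip {x} y x≤y+1/K y→0 ε ε>0 with recip[1+K]<ε (½ * ε) (½ε>0 ε>0)
... | K , 1/K<½ε with y→0 K (½ * ε) (½ε>0 ε>0)
... | N₀ , small = N₀ , λ N N₀≤N → subst (_< ε) (sym (∣p-0∣≡∣p∣ (x N)))
  (ℚP.≤-<-trans (x≤y+1/K K N)
    (subst (∣ y K N ∣ + recip (suc K) <_) (½ε+½ε≡ε ε)
      (ℚP.+-mono-< (subst (_< ½ * ε) (∣p-0∣≡∣p∣ (y K N)) (small N N₀≤N)) 1/K<½ε)))


H-nonNeg : ∀ p N → 0ℚ ℚ.≤ H p N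
H-nonNeg p zero    = ℚP.≤-refl
H-nonNeg p (suc N) = ℚP.+-mono-≤ (H-nonNeg p N) (recip-nonNeg (suc N ℕ.^ p))

Hp≤H1 : ∀ p N → 1 ≤ p → H p N ℚ.≤ H 1 N
Hp≤H1 p zero    _   = ℚP.≤-refl
Hp≤H1 p (suc N) 1≤p = ℚP.+-mono-≤ (Hp≤H1 p N 1≤p) (recip-antitone (ℕP.m^n>0 (suc N) 1) (ℕP.^-monoʳ-≤ (suc N) 1≤p))

H1-suc : ∀ n → H 1 (suc n) ≡ H 1 n + recip (suc n)
H1-suc n = cong (λ m → H 1 n + recip m) (ℕP.^-identityʳ (suc n))

H1≤fromℕ : ∀ N → H 1 N ℚ.≤ fromℕ N
H1≤fromℕ zero    = ℚP.≤-refl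
H1≤fromℕ (suc N) = subst₂ ℚ._≤_ (sym (H1-suc N)) (trans (ℚP.+-comm (fromℕ N) 1ℚ) (sym (fromℕ-+ 1 N)))
  (ℚP.+-mono-≤ (H1≤fromℕ N) (recip≤1 (suc N)))

H1≤[1+K]+N/[1+K] : ∀ K N → H 1 N ℚ.≤ fromℕ (suc K) + fromℕ N * recip (suc K)
H1≤[1+K]+N/[1+K] K zero = ℚP.+-mono-≤ (fromℕ-nonNeg (suc K)) (ℚP.≤-reflexive (sym (ℚP.*-zeroˡ (recip (suc K)))))
H1≤[1+K]+N/[1+K] K (suc N) with suc N ℕP.≤? suc K
... | yes N<K = ℚP.≤-trans (H1≤fromℕ (suc N)) (ℚP.≤-trans (fromℕ-mono N<K)
  (subst (ℚ._≤ fromℕ (suc K) + fromℕ (suc N) * recip (suc K)) (ℚP.+-identityʳ (fromℕ (suc K)))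
    (ℚP.+-monoʳ-≤ (fromℕ (suc K)) (*-nonNeg (fromℕ-nonNeg (suc N)) (recip-nonNeg (suc K))))))
... | no  N≮K = subst₂ ℚ._≤_ (sym (H1-suc N)) regroup
  (ℚP.+-mono-≤ (H1≤[1+K]+N/[1+K] K N) (recip-antitone (s≤s z≤n) (ℕP.<⇒≤ (ℕP.≰⇒> N≮K))))
  where
    regroup : fromℕ (suc K) + fromℕ N * recip (suc K) + recip (suc K) ≡ fromℕ (suc K) + fromℕ (suc N) * recip (suc K)
    regroup = trans (solve 3 (λ A B r → A :+ B :* r :+ r := A :+ (con 1ℚ :+ B) :* r) refl (fromℕ (suc K)) (fromℕ N) (recip (suc K)))
                    (cong (λ x → fromℕ (suc K) + x * recip (suc K)) (sym (fromℕ-+ 1 N)))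
      where open ℚSolver.+-*-Solver

H1/[1+N]≤ : ∀ K N → H 1 N * recip (suc N) ℚ.≤ fromℕ (suc K) * recip (suc N) + recip (suc K)
H1/[1+N]≤ K N = ℚP.≤-trans (ℚP.*-monoʳ-≤-nonNeg rN {{ℚ.nonNegative (recip-nonNeg (suc N))}} (H1≤[1+K]+N/[1+K] K N))
  (subst (ℚ._≤ A * rN + r) expand
    (ℚP.+-monoʳ-≤ (A * rN) (subst (fromℕ N * rN * r ℚ.≤_) (ℚP.*-identityˡ r)
      (ℚP.*-monoʳ-≤-nonNeg r {{ℚ.nonNegative (recip-nonNeg (suc K))}} (fromℕ*recip≤1 N)))))
  where
    open ℚSolver.+-*-Solver
    A = fromℕ (suc K)
    r = recip (suc K)
    rN = recip (suc N)
    expand : A * rN + fromℕ N * rN * r ≡ (A + fromℕ N * r) * rN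
    expand = solve 4 (λ A B r s → A :* s :+ B :* s :* r := (A :+ B :* r) :* s) refl A (fromℕ N) r rN

H1/[1+N]-null : Null (λ N → H 1 N * recip (suc N))
H1/[1+N]-null = null-≤-+recip y bound y→0
  where
    y : ℕ → ℕ → ℚ
    y K N = fromℕ (suc K) * recip (suc N)
    bound : ∀ K N → ∣ H 1 N * recip (suc N) ∣ ℚ.≤ ∣ y K N ∣ + recip (suc K)
    bound K N = subst₂ (λ a b → a ℚ.≤ b + recip (suc K))
      (sym (ℚP.0≤p⇒∣p∣≡p (*-nonNeg (H-nonNeg 1 N) (recip-nonNeg (suc N)))))
      (sym (ℚP.0≤p⇒∣p∣≡p (*-nonNeg (fromℕ-nonNeg (suc K)) (recip-nonNeg (suc N)))))
      (H1/[1+N]≤ K N)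
    y→0 : ∀ K → Null (y K)
    y→0 K = null-*-fromℕ (suc K) (null-cong (λ N → cong (λ m → recip (suc m)) (ℕP.+-identityʳ N)) (recip-null 0))

H1[N]-H1[N+a]-null : ∀ a → Null (λ N → H 1 N - H 1 (N ℕ.+ a))
H1[N]-H1[N+a]-null zero    = null-cong (λ N → sym (trans (cong (λ m → H 1 N - H 1 m) (ℕP.+-identityʳ N)) (ℚP.+-inverseʳ (H 1 N)))) null-zero
H1[N]-H1[N+a]-null (suc a) = null-cong shift
  (null-- {λ N → H 1 N - H 1 (N ℕ.+ a)} {λ N → recip (suc (N ℕ.+ a))} (H1[N]-H1[N+a]-null a) (recip-null a))
  where
    shift : ∀ N → H 1 N - H 1 (N ℕ.+ a) - recip (suc (N ℕ.+ a)) ≡ H 1 N - H 1 (N ℕ.+ suc a)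
    shift N = begin
      H 1 N - H 1 (N ℕ.+ a) - recip (suc (N ℕ.+ a))   ≡⟨ solve 3 (λ x y z → x :- y :- z := x :- (y :+ z)) refl (H 1 N) (H 1 (N ℕ.+ a)) (recip (suc (N ℕ.+ a))) ⟩
      H 1 N - (H 1 (N ℕ.+ a) + recip (suc (N ℕ.+ a))) ≡⟨ cong (_-_ (H 1 N)) (sym (H1-suc (N ℕ.+ a))) ⟩
      H 1 N - H 1 (suc (N ℕ.+ a))                    ≡⟨ cong (λ m → H 1 N - H 1 m) (sym (ℕP.+-suc N a)) ⟩
      H 1 N - H 1 (N ℕ.+ suc a)                      ∎
      where open ℚSolver.+-*-Solver

remainder-one-null : ∀ a p → Null (remainder (suc a) (suc p) 1)
remainder-one-null a p = null-cong (λ N → sym (remainder-one a p N))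
  (null-- {λ N → c * (H 1 N - H 1 (N ℕ.+ suc a))} {λ N → H (suc p) N * recip (suc (N ℕ.+ suc a))}
    (null-*-bounded c 1 ∣c∣≤1 (H1[N]-H1[N+a]-null (suc a)))
    (null-≤ bound H1/[1+N]-null))
  where
    c = negOnePow p * recip (suc a ℕ.^ suc p)
    ∣c∣≤1 : ∣ c ∣ ℚ.≤ 1ℚ
    ∣c∣≤1 = subst (ℚ._≤ 1ℚ) (sym (trans (ℚP.∣p*q∣≡∣p∣*∣q∣ (negOnePow p) _)
                  (trans (cong₂ _*_ (∣negOnePow∣≡1 p) (ℚP.0≤p⇒∣p∣≡p (recip-nonNeg (suc a ℕ.^ suc p)))) (ℚP.*-identityˡ _))))
              (recip≤1 (suc a ℕ.^ suc p))
    bound : ∀ N → ∣ H (suc p) N * recip (suc (N ℕ.+ suc a)) ∣ ℚ.≤ ∣ H 1 N * recip (suc N) ∣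
    bound N = subst₂ ℚ._≤_
      (sym (ℚP.0≤p⇒∣p∣≡p (*-nonNeg (H-nonNeg (suc p) N) (recip-nonNeg (suc (N ℕ.+ suc a))))))
      (sym (ℚP.0≤p⇒∣p∣≡p (*-nonNeg (H-nonNeg 1 N) (recip-nonNeg (suc N)))))
      (ℚP.≤-trans (ℚP.*-monoʳ-≤-nonNeg (recip (suc (N ℕ.+ suc a))) {{ℚ.nonNegative (recip-nonNeg (suc (N ℕ.+ suc a)))}} (Hp≤H1 (suc p) N (s≤s z≤n)))
                  (ℚP.*-monoˡ-≤-nonNeg (H 1 N) {{ℚ.nonNegative (H-nonNeg 1 N)}} (recip-antitone (s≤s z≤n) (s≤s (ℕP.m≤m+n N (suc a))))))

remainder-null : ∀ l m p → Null (remainder (suc m) (suc p) (suc l))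
remainder-null zero    m p = remainder-one-null m p
remainder-null (suc l) m p = null-cong (λ N → sym (remainder-step m (suc p) l N))
  (null-- {remainder (suc m) (suc p) (suc l)} {remainder (suc (suc m)) (suc p) (suc l)} (remainder-null l m p) (remainder-null l (suc m) p))

corollary3 : ∀ (m p l : ℕ) → 1 ≤ m → 1 ≤ p → 1 ≤ l →
    Tendsto (λ N → lhsPartial m p l N - rhsPartial m p l N) 0ℚ
corollary3 (suc m) (suc p) (suc l) _ _ _ = remainder-null l m p
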